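{- Let $A$ be a finite subset of $M_n$. Then $\operatorname{Aut}(M_n)_{\{\operatorname{acl}_{M_n}(A)\}}=\operatorname{Aut}(M_n)_{\{\operatorname{acl}(A)\}}$.
   Context: Let $n\geq 2$ and $\Omega$ a countably infinite set; $[X]^m$ is the set of $m$-subsets of $X$. $\beta^\ast_{n,n-1}:\mathbb{F}_2^{[\Omega]^{n-1}}\to\mathbb{F}_2^{[\Omega]^n}$, $(\beta^\ast_{n,n-1}f)(\omega)=\sum_{x\in[\omega]^{n-1}}f(x)$. $M_n$ is the countable $\aleph_0$-categorical multisorted structure with sorts $\Omega$, $[\Omega]^n$, $[\Omega]^n\times\mathbb{F}_2$ whose automorphism group is $G=\operatorname{Im}\beta^\ast_{n,n-1}\rtimes\operatorname{Sym}(\Omega)$ (e.g. with the $G$-orbits on finite tuples as basic relations), where $g\sigma$ acts on $\Omega$ and $[\Omega]^n$ via $\sigma$ and by $(w,x)\mapsto(w^\sigma,x+g(w))$ on $[\Omega]^n\times\mathbb{F}_2$. $\operatorname{acl}_{M_n}(A)$ is the union of the finite $\operatorname{Aut}(M_n/A)$-orbits in $M_n$; $\operatorname{acl}(A)$ is the union of the finite $\operatorname{Aut}(M_n/A)$-orbits in $M_n^{\mathrm{eq}}$ (on which $\operatorname{Aut}(M_n)$ acts naturally). $\operatorname{Aut}(M_n)_{\{X\}}$ denotes the setwise stabilizer of $X$ in $\operatorname{Aut}(M_n)$. -}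

module Defs where

open import Data.Nat using (ℕ; _<_)
open import Data.Bool using (Bool; true; false; _xor_)
open import Data.List using (List; []; _∷_; length; map; foldr)
open import Data.List.Relation.Unary.Linked using (Linked)
open import Data.List.Relation.Unary.All using (All)
open import Data.List.Relation.Unary.Any using (Any)
open import Data.List.Membership.Propositional using (_∈_)
open import Data.Vec using (Vec)
import Data.Vec.Relation.Unary.All as VAll
open import Data.Vec.Relation.Binary.Pointwise.Inductive using (Pointwise)
open import Data.Product using (Σ; ∃; _×_; _,_)
open import Data.Unit using (⊤)
open import Data.Empty using (⊥)
open import Relation.Binary.PropositionalEquality using (_≡_)

-- Ω is modelled by ℕ (a countably infinite set).

_⇔ₚ_ : Set → Set → Set
P ⇔ₚ Q = (P → Q) × (Q → P)

-- A finite subset of ℕ is represented canonically by the strictly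
-- increasing list of its elements.  [Ω]^m = { ω | NSet m ω }.
NSet : ℕ → List ℕ → Set
NSet m ω = Linked _<_ ω × (length ω ≡ m)

-- All lists obtained from ω by deleting exactly one entry:
-- for an n-set ω these are exactly the elements of [ω]^(n-1).
removals : List ℕ → List (List ℕ)
removals [] = []
removals (x ∷ xs) = xs ∷ map (x ∷_) (removals xs)

-- (β*_{n,n-1} f)(ω) = Σ_{x ∈ [ω]^{n-1}} f(x)   (sum in F₂ = Bool with xor)
βstar : (List ℕ → Bool) → List ℕ → Bool
βstar f ω = foldr _xor_ false (map f (removals ω))

-- Elements of M_n (all three sorts); validity is a separate predicate.
data Elem : Set where
  pt : ℕ → Elem
  st : List ℕ → Elem
  fb : List ℕ → Bool → Elem

Valid : ℕ → Elem → Set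
Valid n (pt x) = ⊤
Valid n (st ω) = NSet n ω
Valid n (fb ω b) = NSet n ω

-- Elements of Aut(M_n) = Im β*_{n,n-1} ⋊ Sym(Ω):  a pair (g , σ).
record Aut (n : ℕ) : Set where
  field
    σ      : ℕ → ℕ
    σ⁻¹    : ℕ → ℕ
    σ-inv₁ : ∀ x → σ⁻¹ (σ x) ≡ x
    σ-inv₂ : ∀ x → σ (σ⁻¹ x) ≡ x
    g      : List ℕ → Bool
    g∈Im   : ∃ λ (f : List ℕ → Bool) → ∀ ω → NSet n ω → g ω ≡ βstar f ω
open Aut public

IsImage : (ℕ → ℕ) → List ℕ → List ℕ → Set
IsImage s ω ω' =
  Linked _<_ ω' × (∀ x → (x ∈ ω') ⇔ₚ (∃ λ y → (y ∈ ω) × (x ≡ s y)))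

Maps : ∀ {n} → Aut n → Elem → Elem → Set
Maps φ (pt x) (pt y) = y ≡ σ φ x
Maps φ (st ω) (st ω') = IsImage (σ φ) ω ω'
Maps φ (fb ω b) (fb ω' b') = IsImage (σ φ) ω ω' × (b' ≡ b xor g φ ω)
Maps φ _ _ = ⊥

MapsV : ∀ {n k} → Aut n → Vec Elem k → Vec Elem k → Set
MapsV φ = Pointwise (Maps φ)

ValidV : ∀ {k} → ℕ → Vec Elem k → Set
ValidV n = VAll.All (Valid n)

Fixes : ∀ {n} → Aut n → List Elem → Set
Fixes φ A = All (λ a → Maps φ a a) A

-- a ∈ acl_{M_n}(A): a lies in a finite Aut(M_n/A)-orbit of M_n
InAclM : (n : ℕ) → List Elem → Elem → Set
InAclM n A a = Valid n a ×
  (∃ λ (L : List Elem) →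
     ∀ (φ : Aut n) → Fixes φ A → ∀ b → Maps φ a b → b ∈ L)

StabAclM : (n : ℕ) → List Elem → Aut n → Set
StabAclM n A φ = ∀ a b → Valid n a → Maps φ a b → InAclM n A a ⇔ₚ InAclM n A b

-- Imaginary sorts of M_n^eq: M_n^k / E for E an ∅-definable equivalence
-- relation on k-tuples; since M_n is ℵ₀-categorical (and its basic relations
-- are the G-orbits), these are exactly the Aut(M_n)-invariant equivalence
-- relations on (valid) k-tuples.
record InvEquiv (n k : ℕ) : Set₁ where
  field
    rel   : Vec Elem k → Vec Elem k → Set
    refl' : ∀ u → ValidV n u → rel u u
    sym'  : ∀ u v → ValidV n u → ValidV n v → rel u v → rel v u
    trans' : ∀ u v w → ValidV n u → ValidV n v → ValidV n w →
             rel u v → rel v w → rel u w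
    inv   : ∀ (φ : Aut n) u v u' v' → ValidV n u → ValidV n v →
            MapsV φ u u' → MapsV φ v v' → rel u v ⇔ₚ rel u' v'
open InvEquiv public

-- the class u/E lies in acl(A) ⊆ M_n^eq: its Aut(M_n/A)-orbit is finite,
-- i.e. covered by finitely many E-classes u'/E.
InAclEq : (n : ℕ) → List Elem → ∀ {k} → InvEquiv n k → Vec Elem k → Set
InAclEq n A {k} E u = ValidV n u ×
  (∃ λ (L : List (Vec Elem k)) → All (ValidV n) L ×
     (∀ (φ : Aut n) → Fixes φ A → ∀ v → MapsV φ u v → Any (rel E v) L))

-- Aut(M_n)_{acl(A)} : φ[acl(A)] = acl(A)  (φ acts on u/E by u/E ↦ φ(u)/E)
StabAclEq : (n : ℕ) → List Elem → Aut n → Set₁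
StabAclEq n A φ = ∀ k (E : InvEquiv n k) u v → ValidV n u → MapsV φ u v →
  InAclEq n A E u ⇔ₚ InAclEq n A E v

{-# OPTIONS --safe #-}

-- Let S = supp(A) be the finite set of points of Ω occurring in A. The points of acl_M(A) are
-- exactly those of S, since a point outside S is moved to any fresh point by a transposition,
-- which fixes A; so an automorphism stabilising acl_M(A) stabilises S. Conversely acl(A)
-- contains the class of [a] under equality of 1-tuples iff a ∈ acl_M(A), so stabilising acl(A)
-- implies stabilising acl_M(A).
-- It remains to see that an automorphism φ stabilising S maps acl(A) into itself. Let the
-- Aut(M/A)-orbit of u be covered by the E-classes of a finite list L and let ψ fix A. Take ρ
-- agreeing with ψ on S, the identity off S, and with F₂-part agreeing with that of ψ on the
-- (n-1)-subsets of the n-sets in φ(A). Then ρ⁻¹ψ fixes φ(A), so κ = φ⁻¹ρ⁻¹ψφ fixes A and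
-- κu E l for some l ∈ L, whence ψφu = ρφκu E ρφl. As ρ is given by two finite tables, the
-- elements ρφl, l ∈ L, lie in a finite list independent of ψ.

module Submission where

open import Defs
open import Algebra.Bundles using (CommutativeRing; CommutativeMonoid)
open import Data.Bool using (Bool; true; false; _xor_)
open import Data.Bool.Properties using (xor-∧-commutativeRing; xor-assoc; xor-identityʳ; xor-same)
open import Data.Empty using (⊥-elim)
open import Data.List
  using (List; []; _∷_; [_]; _++_; length; map; foldr; concatMap; filter; cartesianProductWith)
open import Data.List.Extrema.Nat using (max; xs≤max)
open import Data.List.Membership.Propositional using (_∈_; _∉_; find; lose)
open import Data.List.Membership.Propositional.Properties
  using (∈-map⁺; ∈-map⁻; ∈-++⁺ˡ; ∈-++⁺ʳ; ∈-concatMap⁺; ∈-concatMap⁻; ∈-filter⁺; ∈-cartesianProductWith⁺)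
open import Data.List.Properties
  using (≡-dec; length-map; map-∘; map-id-local; map-cong; map-cong-local)
open import Data.List.Relation.Binary.Equality.Propositional using (≋⇒≡)
open import Data.List.Relation.Binary.Permutation.Propositional
  using (_↭_; refl; prep; swap; ↭-refl; ↭-sym; ↭-trans; ↭-prep; ↭-swap; ↭⇒↭ₛ; module PermutationReasoning)
import Data.List.Relation.Binary.Permutation.Propositional.Properties as ↭
import Data.List.Relation.Binary.Permutation.Setoid.Properties as ↭ₛ
open import Data.List.Relation.Binary.Subset.Propositional using (_⊆_)
open import Data.List.Relation.Unary.All as All using (All; []; _∷_)
import Data.List.Relation.Unary.All.Properties as All
open import Data.List.Relation.Unary.AllPairs as AllPairs using (AllPairs; []; _∷_)
open import Data.List.Relation.Unary.Any using (Any; here; there)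
open import Data.List.Relation.Unary.Linked as Linked using (Linked; []; [-]; _∷_)
open import Data.List.Relation.Unary.Linked.Properties using (Linked⇒AllPairs; AllPairs⇒Linked)
open import Data.List.Relation.Unary.Unique.Propositional using (Unique)
import Data.List.Relation.Unary.Unique.Propositional.Properties as Unique
open import Data.Nat using (ℕ; zero; suc; _≤_; _<_; _≟_)
open import Data.Nat.Properties
  using (n≮n; _<?_; ≤-decTotalOrder; ≤-totalOrder; ≤-trans; <-trans; <-irrefl; <⇒≤; <⇒≢; ≤∧≢⇒<)
open import Data.List.Membership.DecPropositional _≟_ using (_∈?_)
open import Data.List.Relation.Unary.Sorted.TotalOrder ≤-totalOrder using (Sorted)
open import Data.List.Relation.Unary.Sorted.TotalOrder.Properties using (↗↭↗⇒≋)
open import Data.List.Sort ≤-decTotalOrder using (sort; sort-↭; sort-↗)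
open import Data.Product using (∃; _×_; _,_; proj₁; proj₂)
import Data.Product as Product
open import Data.Unit using (tt)
open import Data.Vec using (Vec; []; _∷_)
import Data.Vec as Vec
open import Data.Vec.Relation.Binary.Pointwise.Inductive using ([]; _∷_)
open import Data.Vec.Relation.Unary.All as VecAll using ([]; _∷_)
open import Function using (_∘_; id)
open import Function.Definitions using (Injective)
open import Relation.Binary.Definitions using (DecidableEquality)
open import Relation.Binary.PropositionalEquality
  using (_≡_; _≢_; refl; sym; trans; cong; cong₂; subst; setoid; module ≡-Reasoning)
open import Relation.Nullary using (Dec; yes; no)
open import Relation.Nullary.Decidable using (_×-dec_)

open CommutativeRing xor-∧-commutativeRing using (+-isCommutativeMonoid; +-commutativeMonoid)
open import Algebra.Properties.CommutativeSemigroup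
  (CommutativeMonoid.commutativeSemigroup +-commutativeMonoid) using (interchange)

-- Increasing lists and images of finite sets

Increasing : List ℕ → Set
Increasing = Linked _<_

sort-↭-cong : ∀ {xs ys} → xs ↭ ys → sort xs ≡ sort ys
sort-↭-cong {xs} {ys} p = ≋⇒≡ (↗↭↗⇒≋ ≤-totalOrder (sort-↗ xs) (sort-↗ ys)
  (↭⇒↭ₛ (↭-trans (sort-↭ xs) (↭-trans p (↭-sym (sort-↭ ys))))))

sort-sorted : ∀ {xs} → Sorted xs → sort xs ≡ xs
sort-sorted {xs} s = ≋⇒≡ (↗↭↗⇒≋ ≤-totalOrder (sort-↗ xs) s (↭⇒↭ₛ (sort-↭ xs)))

increasing⇒sorted : ∀ {xs} → Increasing xs → Sorted xs
increasing⇒sorted = Linked.map <⇒≤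

increasing⇒unique : ∀ {xs} → Increasing xs → Unique xs
increasing⇒unique s = AllPairs.map <⇒≢ (Linked⇒AllPairs <-trans s)

sorted∧unique⇒increasing : ∀ {xs} → Sorted xs → Unique xs → Increasing xs
sorted∧unique⇒increasing []          _                = []
sorted∧unique⇒increasing [-]         _                = [-]
sorted∧unique⇒increasing (x≤y ∷ s) ((x≢y ∷ _) ∷ u) = ≤∧≢⇒< x≤y x≢y ∷ sorted∧unique⇒increasing s u

increasing-head< : ∀ {x xs z} → Increasing (x ∷ xs) → z ∈ xs → x < z
increasing-head< s z∈xs with Linked⇒AllPairs <-trans s
... | x<xs ∷ _ = All.lookup x<xs z∈xs

increasing-ext : ∀ {xs ys} → Increasing xs → Increasing ys → xs ⊆ ys → ys ⊆ xs → xs ≡ ys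
increasing-ext {[]}     {[]}     _  _  _  _  = refl
increasing-ext {[]}     {y ∷ _}  _  _  _  ys⊆ with () ← ys⊆ (here refl)
increasing-ext {x ∷ _}  {[]}     _  _  xs⊆ _ with () ← xs⊆ (here refl)
increasing-ext {x ∷ xs} {y ∷ ys} sx sy xs⊆ ys⊆ with xs⊆ (here refl) | ys⊆ (here refl)
... | there x∈ys | there y∈xs =
  ⊥-elim (<-irrefl refl (<-trans (increasing-head< sx y∈xs) (increasing-head< sy x∈ys)))
... | there x∈ys | here refl  = ⊥-elim (<-irrefl refl (increasing-head< sy x∈ys))
... | here refl  | _          =
  cong (x ∷_) (increasing-ext (Linked.tail sx) (Linked.tail sy) (tail⊆ sx sy xs⊆) (tail⊆ sy sx ys⊆))
  where
  tail⊆ : ∀ {u us vs} → Increasing (u ∷ us) → Increasing (u ∷ vs) → u ∷ us ⊆ u ∷ vs → us ⊆ vs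
  tail⊆ su sv ⊆ z∈us with ⊆ (there z∈us)
  ... | here refl = ⊥-elim (<-irrefl refl (increasing-head< su z∈us))
  ... | there z∈vs = z∈vs

image : (ℕ → ℕ) → List ℕ → List ℕ
image f ω = sort (map f ω)

image-increasing : ∀ f {ω} → Injective _≡_ _≡_ f → Increasing ω → Increasing (image f ω)
image-increasing f {ω} inj s = sorted∧unique⇒increasing (sort-↗ (map f ω))
  (↭ₛ.Unique-resp-↭ (setoid ℕ) (↭⇒↭ₛ (↭-sym (sort-↭ (map f ω)))) (Unique.map⁺ inj (increasing⇒unique s)))

image-length : ∀ f ω → length (image f ω) ≡ length ω
image-length f ω = trans (↭.↭-length (sort-↭ (map f ω))) (length-map f ω)

∈-image⁻ : ∀ f ω {x} → x ∈ image f ω → ∃ λ y → y ∈ ω × x ≡ f y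
∈-image⁻ f ω x∈ = ∈-map⁻ f (↭.∈-resp-↭ (sort-↭ (map f ω)) x∈)

∈-image⁺ : ∀ f ω {y} → y ∈ ω → f y ∈ image f ω
∈-image⁺ f ω y∈ = ↭.∈-resp-↭ (↭-sym (sort-↭ (map f ω))) (∈-map⁺ f y∈)

isImage-image : ∀ f {ω} → Injective _≡_ _≡_ f → Increasing ω → IsImage f ω (image f ω)
isImage-image f {ω} inj s =
  image-increasing f inj s , λ x → ∈-image⁻ f ω , λ { (y , y∈ , refl) → ∈-image⁺ f ω y∈ }

isImage⇒≡image : ∀ f {ω ω'} → Injective _≡_ _≡_ f → Increasing ω → IsImage f ω ω' → ω' ≡ image f ω
isImage⇒≡image f {ω} {ω'} inj s (s' , ∈ω'⇔) = increasing-ext s' (image-increasing f inj s) ω'⊆ image⊆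
  where
  ω'⊆ : ω' ⊆ image f ω
  ω'⊆ {z} z∈ with proj₁ (∈ω'⇔ z) z∈
  ... | y , y∈ , refl = ∈-image⁺ f ω y∈
  image⊆ : image f ω ⊆ ω'
  image⊆ {z} z∈ = proj₂ (∈ω'⇔ z) (∈-image⁻ f ω z∈)

image-∘ : ∀ f h ω → image f (image h ω) ≡ image (f ∘ h) ω
image-∘ f h ω = sort-↭-cong (subst (map f (sort (map h ω)) ↭_) (sym (map-∘ ω)) (↭.map⁺ f (sort-↭ (map h ω))))

image-id-on : ∀ f {ω} → (∀ {x} → x ∈ ω → f x ≡ x) → Sorted ω → image f ω ≡ ω
image-id-on f {ω} fix s = trans (cong sort (map-id-local (All.tabulate fix))) (sort-sorted s)

-- Sums over F₂ and β*

xorSum : List Bool → Bool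
xorSum = foldr _xor_ false

xorSum-↭ : ∀ {bs cs} → bs ↭ cs → xorSum bs ≡ xorSum cs
xorSum-↭ p = ↭ₛ.foldr-commMonoid (setoid Bool) +-isCommutativeMonoid (↭⇒↭ₛ p)

xorSum-map-xor : ∀ {A : Set} (f h : A → Bool) xs →
  xorSum (map (λ x → f x xor h x) xs) ≡ xorSum (map f xs) xor xorSum (map h xs)
xorSum-map-xor f h []       = refl
xorSum-map-xor f h (x ∷ xs) = trans (cong ((f x xor h x) xor_) (xorSum-map-xor f h xs))
  (interchange (f x) (h x) (xorSum (map f xs)) (xorSum (map h xs)))

xorSum-false : ∀ {A : Set} (xs : List A) → xorSum (map (λ _ → false) xs) ≡ false
xorSum-false []       = refl
xorSum-false (_ ∷ xs) = xorSum-false xs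

removals-map : ∀ (f : ℕ → ℕ) xs → removals (map f xs) ≡ map (map f) (removals xs)
removals-map f []       = refl
removals-map f (x ∷ xs) = cong (map f xs ∷_) (begin
  map (f x ∷_) (removals (map f xs))       ≡⟨ cong (map (f x ∷_)) (removals-map f xs) ⟩
  map (f x ∷_) (map (map f) (removals xs)) ≡⟨ map-∘ (removals xs) ⟨
  map (map f ∘ (x ∷_)) (removals xs)       ≡⟨ map-∘ (removals xs) ⟩
  map (map f) (map (x ∷_) (removals xs))   ∎)
  where open ≡-Reasoning

∈-removals-⊆ : ∀ {xs r z} → r ∈ removals xs → z ∈ r → z ∈ xs
∈-removals-⊆ {xs = x ∷ xs} (here refl) z∈r = there z∈r
∈-removals-⊆ {xs = x ∷ xs} (there r∈) z∈r with ∈-map⁻ (x ∷_) r∈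
... | r' , r'∈ , refl with z∈r
...   | here refl  = here refl
...   | there z∈r' = there (∈-removals-⊆ r'∈ z∈r')

removals-AllPairs : ∀ {R : ℕ → ℕ → Set} {xs r} →
  AllPairs R xs → r ∈ removals xs → AllPairs R r
removals-AllPairs (_ ∷ pxs) (here refl) = pxs
removals-AllPairs {xs = x ∷ xs} (Rx ∷ pxs) (there r∈) with ∈-map⁻ (x ∷_) r∈
... | r' , r'∈ , refl =
  All.tabulate (All.lookup Rx ∘ ∈-removals-⊆ r'∈) ∷ removals-AllPairs pxs r'∈

removals-sorted : ∀ {xs r} → Sorted xs → r ∈ removals xs → Sorted r
removals-sorted s r∈ = AllPairs⇒Linked (removals-AllPairs (Linked⇒AllPairs ≤-trans s) r∈)

map-removals-↭ : ∀ {B : Set} (h : List ℕ → B) → (∀ {as bs} → as ↭ bs → h as ≡ h bs) →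
  ∀ {xs ys} → xs ↭ ys → map h (removals xs) ↭ map h (removals ys)
map-removals-↭ h h-↭ refl = ↭-refl
map-removals-↭ h h-↭ (prep {xs} {ys} x p) = begin
  h xs ∷ map h (map (x ∷_) (removals xs))  ≡⟨ cong₂ _∷_ (h-↭ p) (sym (map-∘ (removals xs))) ⟩
  h ys ∷ map (h ∘ (x ∷_)) (removals xs)    ↭⟨ ↭-prep (h ys) (map-removals-↭ (h ∘ (x ∷_)) (h-↭ ∘ ↭-prep x) p) ⟩
  h ys ∷ map (h ∘ (x ∷_)) (removals ys)    ≡⟨ cong (h ys ∷_) (map-∘ (removals ys)) ⟩
  h ys ∷ map h (map (x ∷_) (removals ys))  ∎
  where open PermutationReasoning
map-removals-↭ h h-↭ (swap {xs} {ys} x y p) = begin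
  h (y ∷ xs) ∷ h (x ∷ xs) ∷ map h (map (x ∷_) (map (y ∷_) (removals xs)))
    ≡⟨ cong (λ t → _ ∷ _ ∷ t) (trans (map-∘ (removals xs)) (map-∘ _)) ⟨
  h (y ∷ xs) ∷ h (x ∷ xs) ∷ map (h ∘ (x ∷_) ∘ (y ∷_)) (removals xs)
    ↭⟨ ↭-swap _ _ (map-removals-↭ (h ∘ (x ∷_) ∘ (y ∷_)) (h-↭ ∘ ↭-prep x ∘ ↭-prep y) p) ⟩
  h (x ∷ xs) ∷ h (y ∷ xs) ∷ map (h ∘ (x ∷_) ∘ (y ∷_)) (removals ys)
    ≡⟨ cong₂ _∷_ (h-↭ (↭-prep x p)) (cong₂ _∷_ (h-↭ (↭-prep y p))
         (map-cong (λ _ → h-↭ (↭-swap x y ↭-refl)) (removals ys))) ⟩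
  h (x ∷ ys) ∷ h (y ∷ ys) ∷ map (h ∘ (y ∷_) ∘ (x ∷_)) (removals ys)
    ≡⟨ cong (λ t → _ ∷ _ ∷ t) (trans (map-∘ (removals ys)) (map-∘ _)) ⟩
  h (x ∷ ys) ∷ h (y ∷ ys) ∷ map h (map (y ∷_) (map (x ∷_) (removals ys))) ∎
  where open PermutationReasoning
map-removals-↭ h h-↭ (_↭_.trans p q) = ↭-trans (map-removals-↭ h h-↭ p) (map-removals-↭ h h-↭ q)

-- The removals of σ[ω] are, up to order and up to sorting each of them, the σ-images of the
-- removals of ω.
βstar-image : ∀ f σ ω → βstar (f ∘ image σ) ω ≡ βstar f (image σ ω)
βstar-image f σ ω = begin
  xorSum (map (f ∘ sort ∘ map σ) (removals ω))
    ≡⟨ cong xorSum (map-∘ (removals ω)) ⟩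
  xorSum (map (f ∘ sort) (map (map σ) (removals ω)))
    ≡⟨ cong (xorSum ∘ map (f ∘ sort)) (removals-map σ ω) ⟨
  xorSum (map (f ∘ sort) (removals (map σ ω)))
    ≡⟨ xorSum-↭ (map-removals-↭ (f ∘ sort) (cong f ∘ sort-↭-cong) (↭-sym (sort-↭ (map σ ω)))) ⟩
  xorSum (map (f ∘ sort) (removals (image σ ω)))
    ≡⟨ cong xorSum (map-cong-local (All.tabulate (cong f ∘ sort-sorted ∘ removals-sorted (sort-↗ (map σ ω))))) ⟩
  xorSum (map f (removals (image σ ω)))
    ∎
  where open ≡-Reasoning

βstar-xor : ∀ f h ω → βstar (λ x → f x xor h x) ω ≡ βstar f ω xor βstar h ω
βstar-xor f h ω = xorSum-map-xor f h (removals ω)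

xor-cancelʳ : ∀ b c → (b xor c) xor c ≡ b
xor-cancelʳ b c = trans (xor-assoc b c c) (trans (cong (b xor_) (xor-same c)) (xor-identityʳ b))

-- The group Aut(M_n) and its action

left-inverse⇒injective : ∀ {f} (h : ℕ → ℕ) → (∀ x → h (f x) ≡ x) → Injective _≡_ _≡_ f
left-inverse⇒injective h inv {x} {y} fx≡fy = trans (sym (inv x)) (trans (cong h fx≡fy) (inv y))

image-nset : ∀ {n f ω} → Injective _≡_ _≡_ f → NSet n ω → NSet n (image f ω)
image-nset {f = f} {ω} inj (s , len) = image-increasing f inj s , trans (image-length f ω) len

module _ {n : ℕ} (φ : Aut n) where

  σ-injective : Injective _≡_ _≡_ (σ φ)
  σ-injective = left-inverse⇒injective (σ⁻¹ φ) (σ-inv₁ φ)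

  σ⁻¹-injective : Injective _≡_ _≡_ (σ⁻¹ φ)
  σ⁻¹-injective = left-inverse⇒injective (σ φ) (σ-inv₂ φ)

  image-σ⁻¹-σ : ∀ {ω} → Increasing ω → image (σ⁻¹ φ) (image (σ φ) ω) ≡ ω
  image-σ⁻¹-σ {ω} s =
    trans (image-∘ (σ⁻¹ φ) (σ φ) ω) (image-id-on _ (λ {x} _ → σ-inv₁ φ x) (increasing⇒sorted s))

  image-σ-σ⁻¹ : ∀ {ω} → Increasing ω → image (σ φ) (image (σ⁻¹ φ) ω) ≡ ω
  image-σ-σ⁻¹ {ω} s =
    trans (image-∘ (σ φ) (σ⁻¹ φ) ω) (image-id-on _ (λ {x} _ → σ-inv₂ φ x) (increasing⇒sorted s))

_∘ᴬ_ : ∀ {n} → Aut n → Aut n → Aut n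
_∘ᴬ_ {n} φ ψ = record
  { σ      = σ φ ∘ σ ψ
  ; σ⁻¹    = σ⁻¹ ψ ∘ σ⁻¹ φ
  ; σ-inv₁ = λ x → trans (cong (σ⁻¹ ψ) (σ-inv₁ φ (σ ψ x))) (σ-inv₁ ψ x)
  ; σ-inv₂ = λ x → trans (cong (σ φ) (σ-inv₂ ψ (σ⁻¹ φ x))) (σ-inv₂ φ x)
  ; g      = λ ω → g ψ ω xor g φ (image (σ ψ) ω)
  ; g∈Im   = (λ x → fψ x xor fφ (image (σ ψ) x)) , g≡βstar
  }
  where
  fψ = proj₁ (g∈Im ψ)
  fφ = proj₁ (g∈Im φ)
  g≡βstar : ∀ ω → NSet n ω → g ψ ω xor g φ (image (σ ψ) ω) ≡ βstar (λ x → fψ x xor fφ (image (σ ψ) x)) ω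
  g≡βstar ω ω-nset = begin
    g ψ ω xor g φ (image (σ ψ) ω)
      ≡⟨ cong₂ _xor_ (proj₂ (g∈Im ψ) ω ω-nset) (proj₂ (g∈Im φ) _ (image-nset (σ-injective ψ) ω-nset)) ⟩
    βstar fψ ω xor βstar fφ (image (σ ψ) ω)
      ≡⟨ cong (βstar fψ ω xor_) (βstar-image fφ (σ ψ) ω) ⟨
    βstar fψ ω xor βstar (fφ ∘ image (σ ψ)) ω
      ≡⟨ βstar-xor fψ (fφ ∘ image (σ ψ)) ω ⟨
    βstar (λ x → fψ x xor fφ (image (σ ψ) x)) ω
      ∎
    where open ≡-Reasoning

inverse : ∀ {n} → Aut n → Aut n
inverse {n} φ = record
  { σ      = σ⁻¹ φ
  ; σ⁻¹    = σ φ
  ; σ-inv₁ = σ-inv₂ φ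
  ; σ-inv₂ = σ-inv₁ φ
  ; g      = g φ ∘ image (σ⁻¹ φ)
  ; g∈Im   = proj₁ (g∈Im φ) ∘ image (σ⁻¹ φ) , λ ω ω-nset →
      trans (proj₂ (g∈Im φ) _ (image-nset (σ⁻¹-injective φ) ω-nset))
            (sym (βstar-image (proj₁ (g∈Im φ)) (σ⁻¹ φ) ω))
  }

actBy : (ℕ → ℕ) → (List ℕ → Bool) → Elem → Elem
actBy f h (pt x)   = pt (f x)
actBy f h (st ω)   = st (image f ω)
actBy f h (fb ω b) = fb (image f ω) (b xor h ω)

act : ∀ {n} → Aut n → Elem → Elem
act φ = actBy (σ φ) (g φ)

act-valid : ∀ {n} (φ : Aut n) {a} → Valid n a → Valid n (act φ a)
act-valid φ {pt x}   v = v
act-valid φ {st ω}   v = image-nset (σ-injective φ) v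
act-valid φ {fb ω b} v = image-nset (σ-injective φ) v

maps-act : ∀ {n} (φ : Aut n) {a} → Valid n a → Maps φ a (act φ a)
maps-act φ {pt x}   _       = refl
maps-act φ {st ω}   (s , _) = isImage-image (σ φ) (σ-injective φ) s
maps-act φ {fb ω b} (s , _) = isImage-image (σ φ) (σ-injective φ) s , refl

maps⇒≡act : ∀ {n} (φ : Aut n) {a b} → Valid n a → Maps φ a b → b ≡ act φ a
maps⇒≡act φ {pt x}   {pt y}     _       refl          = refl
maps⇒≡act φ {st ω}   {st ω'}    (s , _) ω↦ω'          = cong st (isImage⇒≡image (σ φ) (σ-injective φ) s ω↦ω')
maps⇒≡act φ {fb ω b} {fb ω' b'} (s , _) (ω↦ω' , refl) =
  cong (λ ν → fb ν b') (isImage⇒≡image (σ φ) (σ-injective φ) s ω↦ω')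

maps-valid : ∀ {n} (φ : Aut n) {a b} → Valid n a → Maps φ a b → Valid n b
maps-valid φ {a} va a↦b = subst (Valid _) (sym (maps⇒≡act φ va a↦b)) (act-valid φ va)

act≡⇒maps : ∀ {n} (ψ : Aut n) {a b} → Valid n a → act ψ a ≡ b → Maps ψ a b
act≡⇒maps ψ {a} va eq = subst (Maps ψ a) eq (maps-act ψ va)

act-∘ : ∀ {n} (φ ψ : Aut n) a → act (φ ∘ᴬ ψ) a ≡ act φ (act ψ a)
act-∘ φ ψ (pt x)   = refl
act-∘ φ ψ (st ω)   = cong st (sym (image-∘ (σ φ) (σ ψ) ω))
act-∘ φ ψ (fb ω b) = cong₂ fb (sym (image-∘ (σ φ) (σ ψ) ω)) (sym (xor-assoc b (g ψ ω) _))

act-inverse-act : ∀ {n} (φ : Aut n) {a} → Valid n a → act (inverse φ) (act φ a) ≡ a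
act-inverse-act φ {pt x}   _       = cong pt (σ-inv₁ φ x)
act-inverse-act φ {st ω}   (s , _) = cong st (image-σ⁻¹-σ φ s)
act-inverse-act φ {fb ω b} (s , _) rewrite image-σ⁻¹-σ φ s = cong (fb ω) (xor-cancelʳ b (g φ ω))

act-act-inverse : ∀ {n} (φ : Aut n) {a} → Valid n a → act φ (act (inverse φ) a) ≡ a
act-act-inverse φ {pt x}   _       = cong pt (σ-inv₂ φ x)
act-act-inverse φ {st ω}   (s , _) = cong st (image-σ-σ⁻¹ φ s)
act-act-inverse φ {fb ω b} (s , _) rewrite image-σ-σ⁻¹ φ s = cong (fb ω) (xor-cancelʳ b _)

actV : ∀ {n k} → Aut n → Vec Elem k → Vec Elem k
actV φ = Vec.map (act φ)

actV-valid : ∀ {n k} (φ : Aut n) {u : Vec Elem k} → ValidV n u → ValidV n (actV φ u)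
actV-valid φ []       = []
actV-valid φ (v ∷ vs) = act-valid φ v ∷ actV-valid φ vs

mapsV-actV : ∀ {n k} (φ : Aut n) {u : Vec Elem k} → ValidV n u → MapsV φ u (actV φ u)
mapsV-actV φ []       = []
mapsV-actV φ (v ∷ vs) = maps-act φ v ∷ mapsV-actV φ vs

mapsV⇒≡actV : ∀ {n k} (φ : Aut n) {u w : Vec Elem k} → ValidV n u → MapsV φ u w → w ≡ actV φ u
mapsV⇒≡actV φ []       []       = refl
mapsV⇒≡actV φ (v ∷ vs) (m ∷ ms) = cong₂ _∷_ (maps⇒≡act φ v m) (mapsV⇒≡actV φ vs ms)

actV-∘ : ∀ {n k} (φ ψ : Aut n) (u : Vec Elem k) → actV (φ ∘ᴬ ψ) u ≡ actV φ (actV ψ u)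
actV-∘ φ ψ []      = refl
actV-∘ φ ψ (a ∷ u) = cong₂ _∷_ (act-∘ φ ψ a) (actV-∘ φ ψ u)

actV-inverse-actV : ∀ {n k} (φ : Aut n) {u : Vec Elem k} → ValidV n u → actV (inverse φ) (actV φ u) ≡ u
actV-inverse-actV φ []       = refl
actV-inverse-actV φ (v ∷ vs) = cong₂ _∷_ (act-inverse-act φ v) (actV-inverse-actV φ vs)

actV-actV-inverse : ∀ {n k} (φ : Aut n) {u : Vec Elem k} → ValidV n u → actV φ (actV (inverse φ) u) ≡ u
actV-actV-inverse φ []       = refl
actV-actV-inverse φ (v ∷ vs) = cong₂ _∷_ (act-act-inverse φ v) (actV-actV-inverse φ vs)

valid? : ∀ n a → Dec (Valid n a)
valid? n (pt x)   = yes tt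
valid? n (st ω)   = Linked.linked? _<?_ ω ×-dec (length ω ≟ n)
valid? n (fb ω b) = Linked.linked? _<?_ ω ×-dec (length ω ≟ n)

validV? : ∀ n {k} (u : Vec Elem k) → Dec (ValidV n u)
validV? n = VecAll.all? (valid? n)

-- Supports and the points of acl_M(A)

support : Elem → List ℕ
support (pt x)   = [ x ]
support (st ω)   = ω
support (fb ω _) = ω

supports : List Elem → List ℕ
supports = concatMap support

∈-supports : ∀ {a A s} → a ∈ A → s ∈ support a → s ∈ supports A
∈-supports a∈A s∈a = ∈-concatMap⁺ support (lose a∈A s∈a)

∈-support-act⁻ : ∀ {n} (φ : Aut n) a {s} → s ∈ support (act φ a) → ∃ λ y → y ∈ support a × s ≡ σ φ y
∈-support-act⁻ φ (pt x)   (here refl) = x , here refl , refl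
∈-support-act⁻ φ (st ω)   s∈          = ∈-image⁻ (σ φ) ω s∈
∈-support-act⁻ φ (fb ω b) s∈          = ∈-image⁻ (σ φ) ω s∈

act-id-on : ∀ {n} (ψ : Aut n) {a} → Valid n a → (∀ {s} → s ∈ support a → σ ψ s ≡ s) →
  (∀ {ω b} → a ≡ fb ω b → g ψ ω ≡ false) → act ψ a ≡ a
act-id-on ψ {pt x}   _       fix _        = cong pt (fix (here refl))
act-id-on ψ {st ω}   (s , _) fix _        = cong st (image-id-on (σ ψ) fix (increasing⇒sorted s))
act-id-on ψ {fb ω b} (s , _) fix no-shift = cong₂ fb (image-id-on (σ ψ) fix (increasing⇒sorted s))
  (trans (cong (b xor_) (no-shift refl)) (xor-identityʳ b))

Stabilizes : ∀ {n} → Aut n → List ℕ → Set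
Stabilizes φ S = ∀ {s} → s ∈ S → σ φ s ∈ S × σ⁻¹ φ s ∈ S

isImage-self⇒stabilizes : ∀ {n} (ψ : Aut n) {ω} → IsImage (σ ψ) ω ω → Stabilizes ψ ω
isImage-self⇒stabilizes ψ {ω} (_ , ∈ω⇔) {s} s∈ω = proj₂ (∈ω⇔ _) (s , s∈ω , refl) , σ⁻¹s∈ω (proj₁ (∈ω⇔ s) s∈ω)
  where
  σ⁻¹s∈ω : ∃ (λ y → y ∈ ω × s ≡ σ ψ y) → σ⁻¹ ψ s ∈ ω
  σ⁻¹s∈ω (y , y∈ω , refl) = subst (_∈ ω) (sym (σ-inv₁ ψ y)) y∈ω

maps-self⇒stabilizes-support : ∀ {n} (ψ : Aut n) {a} → Maps ψ a a → Stabilizes ψ (support a)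
maps-self⇒stabilizes-support ψ {pt x}   x≡ψx       (here refl) =
  here (sym x≡ψx) , here (trans (cong (σ⁻¹ ψ) x≡ψx) (σ-inv₁ ψ x))
maps-self⇒stabilizes-support ψ {st ω}   ω↦ω        = isImage-self⇒stabilizes ψ ω↦ω
maps-self⇒stabilizes-support ψ {fb ω b} (ω↦ω , _) = isImage-self⇒stabilizes ψ ω↦ω

fixes⇒stabilizes-supports : ∀ {n} (ψ : Aut n) {A} → Fixes ψ A → Stabilizes ψ (supports A)
fixes⇒stabilizes-supports ψ {A} ψ-fix s∈ with find (∈-concatMap⁻ support {xs = A} s∈)
... | a , a∈A , s∈a = Product.map (∈-supports a∈A) (∈-supports a∈A)
  (maps-self⇒stabilizes-support ψ (All.lookup ψ-fix a∈A) s∈a)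

transpose : ℕ → ℕ → ℕ → ℕ
transpose x y z with z ≟ x
... | yes _ = y
... | no _ with z ≟ y
...   | yes _ = x
...   | no _  = z

transpose-fix : ∀ {x y z} → z ≢ x → z ≢ y → transpose x y z ≡ z
transpose-fix {x} {y} {z} z≢x z≢y with z ≟ x
... | yes z≡x = ⊥-elim (z≢x z≡x)
... | no _ with z ≟ y
...   | yes z≡y = ⊥-elim (z≢y z≡y)
...   | no _    = refl

transpose-x : ∀ x y → transpose x y x ≡ y
transpose-x x y with x ≟ x
... | yes _   = refl
... | no x≢x = ⊥-elim (x≢x refl)

transpose-y : ∀ x y → transpose x y y ≡ x
transpose-y x y with y ≟ x
... | yes y≡x = y≡x
... | no _ with y ≟ y
...   | yes _   = refl
...   | no y≢y = ⊥-elim (y≢y refl)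

transpose-involutive : ∀ x y z → transpose x y (transpose x y z) ≡ z
transpose-involutive x y z with z ≟ x
... | yes refl = transpose-y z y
... | no z≢x with z ≟ y
...   | yes refl = transpose-x x z
...   | no z≢y   = transpose-fix z≢x z≢y

transposition : ∀ n → ℕ → ℕ → Aut n
transposition n x y = record
  { σ = transpose x y ; σ⁻¹ = transpose x y
  ; σ-inv₁ = transpose-involutive x y ; σ-inv₂ = transpose-involutive x y
  ; g = λ _ → false ; g∈Im = (λ _ → false) , λ ω _ → sym (xorSum-false (removals ω))
  }

transposition-fixes : ∀ {n A x y} → All (Valid n) A → x ∉ supports A → y ∉ supports A →
  Fixes (transposition n x y) A
transposition-fixes {n} {A} {x} {y} vA x∉ y∉ = All.tabulate λ a∈A →
  act≡⇒maps τ (All.lookup vA a∈A) (act-id-on τ (All.lookup vA a∈A) (fix a∈A) (λ _ → refl))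
  where
  τ = transposition n x y
  fix : ∀ {a} → a ∈ A → ∀ {s} → s ∈ support a → transpose x y s ≡ s
  fix a∈A s∈a = transpose-fix (λ { refl → x∉ (∈-supports a∈A s∈a) }) (λ { refl → y∉ (∈-supports a∈A s∈a) })

fresh : List ℕ → ℕ
fresh xs = suc (max 0 xs)

fresh-∉ : ∀ xs → fresh xs ∉ xs
fresh-∉ xs fresh∈xs = n≮n _ (All.lookup (xs≤max 0 xs) fresh∈xs)

∈supports⇒pt∈aclM : ∀ {n A x} → x ∈ supports A → InAclM n A (pt x)
∈supports⇒pt∈aclM {A = A} x∈ = tt , map pt (supports A) , λ where
  ψ ψ-fix (pt y) refl → ∈-map⁺ pt (proj₁ (fixes⇒stabilizes-supports ψ ψ-fix x∈))

pt∈aclM⇒∈supports : ∀ {n A x} → All (Valid n) A → InAclM n A (pt x) → x ∈ supports A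
pt∈aclM⇒∈supports {n} {A} {x} vA (_ , L , orbit⊆L) with x ∈? supports A
... | yes x∈ = x∈
... | no x∉  = ⊥-elim (fresh-∉ avoid (there (∈-++⁺ʳ (supports A) (∈-supports pty∈L (here refl)))))
  where
  avoid = x ∷ supports A ++ supports L
  y = fresh avoid
  pty∈L : pt y ∈ L
  pty∈L = orbit⊆L (transposition n x y) (transposition-fixes vA x∉ (fresh-∉ avoid ∘ there ∘ ∈-++⁺ˡ))
    (pt y) (sym (transpose-x x y))

stabAclM⇒stabilizes : ∀ {n A} (φ : Aut n) → All (Valid n) A → StabAclM n A φ → Stabilizes φ (supports A)
stabAclM⇒stabilizes φ vA stab {s} s∈ =
  pt∈aclM⇒∈supports vA (proj₁ (stab (pt s) (pt (σ φ s)) tt refl) (∈supports⇒pt∈aclM s∈)) ,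
  pt∈aclM⇒∈supports vA (proj₂ (stab (pt (σ⁻¹ φ s)) (pt s) tt (sym (σ-inv₂ φ s))) (∈supports⇒pt∈aclM s∈))

-- Equality as an invariant equivalence relation

≡-invEquiv : ∀ n k → InvEquiv n k
≡-invEquiv n k = record
  { rel = _≡_ ; refl' = λ _ _ → refl ; sym' = λ _ _ _ _ → sym ; trans' = λ _ _ _ _ _ _ → trans
  ; inv = invariance }
  where
  invariance : ∀ (φ : Aut n) u v u' v' → ValidV n u → ValidV n v →
    MapsV φ u u' → MapsV φ v v' → (u ≡ v) ⇔ₚ (u' ≡ v')
  invariance φ u v u' v' vu vv u↦u' v↦v' rewrite mapsV⇒≡actV φ vu u↦u' | mapsV⇒≡actV φ vv v↦v' =
    cong (actV φ) ,
    λ eq → trans (sym (actV-inverse-actV φ vu)) (trans (cong (actV (inverse φ)) eq) (actV-inverse-actV φ vv))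

aclM⇒aclEq-singleton : ∀ {n A a} → InAclM n A a → InAclEq n A (≡-invEquiv n 1) Vec.[ a ]
aclM⇒aclEq-singleton {n} {A} {a} (va , L , orbit⊆L) =
  va ∷ [] , map Vec.[_] (filter (valid? n) L) ,
  All.map⁺ (All.map (_∷ []) (All.all-filter (valid? n) L)) , covered
  where
  covered : ∀ (ψ : Aut n) → Fixes ψ A → ∀ v → MapsV ψ Vec.[ a ] v → v ∈ map Vec.[_] (filter (valid? n) L)
  covered ψ ψ-fix (b ∷ []) (a↦b ∷ []) =
    ∈-map⁺ Vec.[_] (∈-filter⁺ (valid? n) (orbit⊆L ψ ψ-fix b a↦b) (maps-valid ψ va a↦b))

aclEq-singleton⇒aclM : ∀ {n A a} → InAclEq n A (≡-invEquiv n 1) Vec.[ a ] → InAclM n A a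
aclEq-singleton⇒aclM ((va ∷ []) , L , _ , covered) =
  va , map Vec.head L , λ ψ ψ-fix b a↦b → ∈-map⁺ Vec.head (covered ψ ψ-fix Vec.[ b ] (a↦b ∷ []))

stabAclEq⇒stabAclM : ∀ {n A} (φ : Aut n) → StabAclEq n A φ → StabAclM n A φ
stabAclEq⇒stabAclM {n} φ stab a b va a↦b =
  aclEq-singleton⇒aclM ∘ proj₁ [a]⇔[b] ∘ aclM⇒aclEq-singleton ,
  aclEq-singleton⇒aclM ∘ proj₂ [a]⇔[b] ∘ aclM⇒aclEq-singleton
  where
  [a]⇔[b] = stab 1 (≡-invEquiv n 1) Vec.[ a ] Vec.[ b ] (va ∷ []) (a↦b ∷ [])

-- Automorphisms read off finite tables

lookupOr : {K V : Set} → DecidableEquality K → List K → List V → (K → V) → K → V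
lookupOr _≟ₖ_ (k ∷ ks) (v ∷ vs) d x with x ≟ₖ k
... | yes _ = v
... | no _  = lookupOr _≟ₖ_ ks vs d x
lookupOr _≟ₖ_ _ _ d x = d x

lookupOr-map : ∀ {K V : Set} (_≟ₖ_ : DecidableEquality K) {ks} (f : K → V) {d x} →
  x ∈ ks → lookupOr _≟ₖ_ ks (map f ks) d x ≡ f x
lookupOr-map _≟ₖ_ {k ∷ ks} f {x = x} x∈ with x ≟ₖ k | x∈
... | yes refl | _          = refl
... | no x≢k  | here x≡k   = ⊥-elim (x≢k x≡k)
... | no _    | there x∈ks = lookupOr-map _≟ₖ_ f x∈ks

lookupOr-∉ : ∀ {K V : Set} (_≟ₖ_ : DecidableEquality K) {ks vs} {d : K → V} {x} →
  x ∉ ks → lookupOr _≟ₖ_ ks vs d x ≡ d x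
lookupOr-∉ _≟ₖ_ {[]}     {vs}     x∉ = refl
lookupOr-∉ _≟ₖ_ {k ∷ ks} {[]}     x∉ = refl
lookupOr-∉ _≟ₖ_ {k ∷ ks} {v ∷ vs} {x = x} x∉ with x ≟ₖ k
... | yes x≡k = ⊥-elim (x∉ (here x≡k))
... | no _    = lookupOr-∉ _≟ₖ_ (x∉ ∘ there)

lookupOr-id-inverse : ∀ {S} {f h : ℕ → ℕ} → (∀ {s} → s ∈ S → f s ∈ S) → (∀ s → h (f s) ≡ s) →
  ∀ x → lookupOr _≟_ S (map h S) id (lookupOr _≟_ S (map f S) id x) ≡ x
lookupOr-id-inverse {S} {f} {h} f-closed hf x with x ∈? S
... | yes x∈ = trans (cong (lookupOr _≟_ S (map h S) id) (lookupOr-map _≟_ f x∈))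
                 (trans (lookupOr-map _≟_ h (f-closed x∈)) (hf x))
... | no x∉  = trans (cong (lookupOr _≟_ S (map h S) id) (lookupOr-∉ _≟_ x∉)) (lookupOr-∉ _≟_ x∉)

listsOver : {A : Set} → List A → ℕ → List (List A)
listsOver B zero    = [ [] ]
listsOver B (suc k) = cartesianProductWith _∷_ B (listsOver B k)

∈-listsOver : ∀ {A : Set} {B : List A} {xs} → All (_∈ B) xs → xs ∈ listsOver B (length xs)
∈-listsOver []         = here refl
∈-listsOver (x∈ ∷ xs∈) = ∈-cartesianProductWith⁺ _∷_ x∈ (∈-listsOver xs∈)

bools : List Bool
bools = true ∷ false ∷ []

∈-bools : ∀ b → b ∈ bools
∈-bools true  = here refl
∈-bools false = there (here refl)

restrictedPairs : List ℕ → List (List ℕ) → List ((ℕ → ℕ) × (List ℕ → Bool))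
restrictedPairs S D = cartesianProductWith
  (λ T bs → lookupOr _≟_ S T id , βstar (lookupOr (≡-dec _≟_) D bs (λ _ → false)))
  (listsOver S (length S)) (listsOver bools (length D))

module Restriction {n} (S : List ℕ) (D : List (List ℕ)) (ψ : Aut n) (ψ-stab : Stabilizes ψ S) where

  private
    f = proj₁ (g∈Im ψ)

  restriction : Aut n
  restriction = record
    { σ      = lookupOr _≟_ S (map (σ ψ) S) id
    ; σ⁻¹    = lookupOr _≟_ S (map (σ⁻¹ ψ) S) id
    ; σ-inv₁ = lookupOr-id-inverse (proj₁ ∘ ψ-stab) (σ-inv₁ ψ)
    ; σ-inv₂ = lookupOr-id-inverse (proj₂ ∘ ψ-stab) (σ-inv₂ ψ)
    ; g      = βstar (lookupOr (≡-dec _≟_) D (map f D) (λ _ → false))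
    ; g∈Im   = _ , λ _ _ → refl
    }

  restriction-∈ : (σ restriction , g restriction) ∈ restrictedPairs S D
  restriction-∈ = ∈-cartesianProductWith⁺ _
    (subst (λ k → map (σ ψ) S ∈ listsOver S k) (length-map (σ ψ) S)
      (∈-listsOver (All.map⁺ (All.tabulate (proj₁ ∘ ψ-stab)))))
    (subst (λ k → map f D ∈ listsOver bools k) (length-map f D)
      (∈-listsOver (All.tabulate (λ {b} _ → ∈-bools b))))

  g-restriction : ∀ {ω} → NSet n ω → removals ω ⊆ D → g restriction ω ≡ g ψ ω
  g-restriction {ω} ω-nset ω⊆D =
    trans (cong xorSum (map-cong-local (All.tabulate (lookupOr-map (≡-dec _≟_) f ∘ ω⊆D))))
          (sym (proj₂ (g∈Im ψ) ω ω-nset))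

  κ : Aut n
  κ = inverse restriction ∘ᴬ ψ

  σκ-id-on : ∀ {s} → s ∈ S → σ κ s ≡ s
  σκ-id-on s∈ = trans (lookupOr-map _≟_ (σ⁻¹ ψ) (proj₁ (ψ-stab s∈))) (σ-inv₁ ψ _)

  κ-id-on : ∀ {a} → Valid n a → support a ⊆ S → removals (support a) ⊆ D → act κ a ≡ a
  κ-id-on {a} va a⊆S a⊆D = act-id-on κ va (σκ-id-on ∘ a⊆S) no-shift
    where
    no-shift : ∀ {ω b} → a ≡ fb ω b → g κ ω ≡ false
    no-shift {ω} refl = begin
      g ψ ω xor g restriction (image (σ⁻¹ restriction) (image (σ ψ) ω))
        ≡⟨ cong (λ ν → g ψ ω xor g restriction ν) (image-∘ _ _ ω) ⟩
      g ψ ω xor g restriction (image (σ κ) ω)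
        ≡⟨ cong (λ ν → g ψ ω xor g restriction ν)
             (image-id-on (σ κ) (σκ-id-on ∘ a⊆S) (increasing⇒sorted (proj₁ va))) ⟩
      g ψ ω xor g restriction ω
        ≡⟨ cong (g ψ ω xor_) (g-restriction va a⊆D) ⟩
      g ψ ω xor g ψ ω
        ≡⟨ xor-same (g ψ ω) ⟩
      false ∎
      where open ≡-Reasoning

-- Stabilisers of supp(A) preserve acl(A)

conjugate-fixes : ∀ {n A} (φ κ : Aut n) → All (Valid n) A →
  (∀ {a} → a ∈ A → act κ (act φ a) ≡ act φ a) → Fixes (inverse φ ∘ᴬ (κ ∘ᴬ φ)) A
conjugate-fixes φ κ vA κ-fix = All.tabulate λ {a} a∈A → act≡⇒maps _ (All.lookup vA a∈A) (begin
  act (inverse φ ∘ᴬ (κ ∘ᴬ φ)) a       ≡⟨ act-∘ (inverse φ) (κ ∘ᴬ φ) a ⟩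
  act (inverse φ) (act (κ ∘ᴬ φ) a)     ≡⟨ cong (act (inverse φ)) (trans (act-∘ κ φ a) (κ-fix a∈A)) ⟩
  act (inverse φ) (act φ a)            ≡⟨ act-inverse-act φ (All.lookup vA a∈A) ⟩
  a                                    ∎)
  where open ≡-Reasoning

actV-conjugate : ∀ {n k} (φ ρ ψ : Aut n) {u : Vec Elem k} → ValidV n u →
  actV ρ (actV φ (actV (inverse φ ∘ᴬ ((inverse ρ ∘ᴬ ψ) ∘ᴬ φ)) u)) ≡ actV ψ (actV φ u)
actV-conjugate φ ρ ψ {u} vu = begin
  actV ρ (actV φ (actV (inverse φ ∘ᴬ (κ ∘ᴬ φ)) u))
    ≡⟨ cong (actV ρ ∘ actV φ) (actV-∘ (inverse φ) (κ ∘ᴬ φ) u) ⟩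
  actV ρ (actV φ (actV (inverse φ) (actV (κ ∘ᴬ φ) u)))
    ≡⟨ cong (actV ρ) (actV-actV-inverse φ (actV-valid (κ ∘ᴬ φ) vu)) ⟩
  actV ρ (actV (κ ∘ᴬ φ) u)
    ≡⟨ cong (actV ρ) (trans (actV-∘ κ φ u) (actV-∘ (inverse ρ) ψ (actV φ u))) ⟩
  actV ρ (actV (inverse ρ) (actV ψ (actV φ u)))
    ≡⟨ actV-actV-inverse ρ (actV-valid ψ (actV-valid φ vu)) ⟩
  actV ψ (actV φ u)
    ∎
  where
  κ = inverse ρ ∘ᴬ ψ
  open ≡-Reasoning

rel-actV : ∀ {n k} (E : InvEquiv n k) (φ : Aut n) {u v} → ValidV n u → ValidV n v →
  rel E u v → rel E (actV φ u) (actV φ v)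
rel-actV E φ {u} {v} vu vv = proj₁ (inv E φ u v _ _ vu vv (mapsV-actV φ vu) (mapsV-actV φ vv))

module _ {n} {A : List Elem} (φ : Aut n) (vA : All (Valid n) A) (φ-stab : Stabilizes φ (supports A)) where

  private
    S = supports A
    D = concatMap (removals ∘ support ∘ act φ) A

  candidates : ∀ {k} → List (Vec Elem k) → List (Vec Elem k)
  candidates L = concatMap (λ (f , h) → map (Vec.map (actBy f h) ∘ actV φ) L) (restrictedPairs S D)

  support-act⊆ : ∀ {a} → a ∈ A → support (act φ a) ⊆ S
  support-act⊆ {a} a∈A s∈ with ∈-support-act⁻ φ a s∈
  ... | y , y∈a , refl = proj₁ (φ-stab (∈-supports a∈A y∈a))

  aclEq-actV : ∀ {k} (E : InvEquiv n k) {u} → ValidV n u → InAclEq n A E u → InAclEq n A E (actV φ u)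
  aclEq-actV E {u} vu (_ , L , vL , orbit-covered) =
    actV-valid φ vu , filter (validV? n) (candidates L) , All.all-filter (validV? n) (candidates L) , covered
    where
    covered : ∀ ψ → Fixes ψ A → ∀ w → MapsV ψ (actV φ u) w → Any (rel E w) (filter (validV? n) (candidates L))
    covered ψ ψ-fix w φu↦w = via (proj₂ (find (orbit-covered κ' κ'-fixes (actV κ' u) (mapsV-actV κ' vu))))
      where
      open Restriction S D ψ (fixes⇒stabilizes-supports ψ ψ-fix)
      κ' = inverse φ ∘ᴬ (κ ∘ᴬ φ)
      κ'-fixes : Fixes κ' A
      κ'-fixes = conjugate-fixes φ κ vA λ a∈A →
        κ-id-on (act-valid φ (All.lookup vA a∈A)) (support-act⊆ a∈A) (∈-concatMap⁺ _ ∘ lose a∈A)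
      w≡ : actV restriction (actV φ (actV κ' u)) ≡ w
      w≡ = trans (actV-conjugate φ restriction ψ vu) (sym (mapsV⇒≡actV ψ (actV-valid φ vu) φu↦w))
      via : ∀ {l} → l ∈ L × rel E (actV κ' u) l → Any (rel E w) (filter (validV? n) (candidates L))
      via {l} (l∈L , κ'u~l) = lose
        (∈-filter⁺ (validV? n) (∈-concatMap⁺ _ (lose restriction-∈ (∈-map⁺ _ l∈L)))
          (actV-valid restriction (actV-valid φ vl)))
        (subst (λ x → rel E x _) w≡
          (rel-actV E restriction (actV-valid φ vκ'u) (actV-valid φ vl) (rel-actV E φ vκ'u vl κ'u~l)))
        where
        vl = All.lookup vL l∈L
        vκ'u = actV-valid κ' vu

stabilizes⇒stabAclEq : ∀ {n A} (φ : Aut n) → All (Valid n) A → Stabilizes φ (supports A) → StabAclEq n A φ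
stabilizes⇒stabAclEq φ vA φ-stab k E u v vu u↦v rewrite mapsV⇒≡actV φ vu u↦v =
  aclEq-actV φ vA φ-stab E vu ,
  subst (InAclEq _ _ E) (actV-inverse-actV φ vu) ∘
    aclEq-actV (inverse φ) vA (Product.swap ∘ φ-stab) E (actV-valid φ vu)

corollary4p6 : (n : ℕ) → 2 ≤ n → (A : List Elem) → All (Valid n) A →
    (φ : Aut n) → (StabAclM n A φ → StabAclEq n A φ) × (StabAclEq n A φ → StabAclM n A φ)
corollary4p6 n _ A vA φ =
  stabilizes⇒stabAclEq φ vA ∘ stabAclM⇒stabilizes φ vA , stabAclEq⇒stabAclM φ
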